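{- The $6\times 6$ grid $P_6\Box P_6$ is not $5$-path-pairable: there exist $5$ pairwise disjoint pairs of vertices $\{s_i,t_i\}$, $1\le i\le 5$ (ten distinct vertices), such that there are no pairwise edge-disjoint $s_i,t_i$-paths, $1\le i\le 5$, in $P_6\Box P_6$.
   Context: $P_6\Box P_6$ is the graph with vertex set $\{(i,j):1\le i,j\le 6\}$ in which $(i,j)$ and $(p,q)$ are adjacent if and only if $|p-i|+|q-j|=1$. A graph is $k$-path-pairable if for any set of $k$ disjoint pairs of vertices $\{s_i,t_i\}$, $1\le i\le k$, there exist pairwise edge-disjoint $s_i,t_i$-paths, $1\le i\le k$. -}

module Defs where

open import Data.Nat using (ℕ; suc)
open import Data.Fin using (Fin; toℕ)
open import Data.Product using (_×_; _,_; proj₁; proj₂; Σ; ∃)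
open import Data.Sum using (_⊎_)
open import Data.List using (List; []; _∷_)
open import Data.List.Membership.Propositional using (_∈_)
open import Data.List.Relation.Unary.Unique.Propositional using (Unique)
open import Data.Empty using (⊥)
open import Relation.Nullary using (¬_)
open import Relation.Binary.PropositionalEquality using (_≡_; _≢_)

Vertex : ℕ → Set
Vertex n = Fin n × Fin n

Diff1 : ℕ → ℕ → Set
Diff1 a b = suc a ≡ b ⊎ suc b ≡ a

Adj : ∀ {n} → Vertex n → Vertex n → Set
Adj (i , j) (p , q) =
  (i ≡ p × Diff1 (toℕ j) (toℕ q)) ⊎ (j ≡ q × Diff1 (toℕ i) (toℕ p))

data IsWalk {n} : List (Vertex n) → Set where
  single : ∀ v → IsWalk (v ∷ [])
  step   : ∀ u v vs → Adj u v → IsWalk (v ∷ vs) → IsWalk (u ∷ v ∷ vs)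

data UsesEdge {n} (u v : Vertex n) : List (Vertex n) → Set where
  here-fw : ∀ vs → UsesEdge u v (u ∷ v ∷ vs)
  here-bw : ∀ vs → UsesEdge u v (v ∷ u ∷ vs)
  there   : ∀ w vs → UsesEdge u v vs → UsesEdge u v (w ∷ vs)

data EndsAt {A : Set} (t : A) : List A → Set where
  end  : EndsAt t (t ∷ [])
  more : ∀ x xs → EndsAt t xs → EndsAt t (x ∷ xs)

record Path {n} (s t : Vertex n) : Set where
  constructor mkPath
  field
    vertices : List (Vertex n)
    walk     : IsWalk vertices
    distinct : Unique vertices
    start    : Σ (List (Vertex n)) (λ rest → vertices ≡ s ∷ rest)
    finish   : EndsAt t vertices
open Path public

EdgeDisjoint : ∀ {n} → List (Vertex n) → List (Vertex n) → Set
EdgeDisjoint {n} P Q = ∀ (u v : Vertex n) → UsesEdge u v P → UsesEdge u v Q → ⊥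

DisjointPairs : ∀ {n k} → (Fin k → Vertex n × Vertex n) → Set
DisjointPairs {k = k} st =
  (∀ i → proj₁ (st i) ≢ proj₂ (st i)) ×
  (∀ i j → i ≢ j →
     (proj₁ (st i) ≢ proj₁ (st j)) × (proj₁ (st i) ≢ proj₂ (st j)) ×
     (proj₂ (st i) ≢ proj₁ (st j)) × (proj₂ (st i) ≢ proj₂ (st j)))

Linkable : ∀ {n k} → (Fin k → Vertex n × Vertex n) → Set
Linkable {n} {k} st =
  Σ ((i : Fin k) → Path (proj₁ (st i)) (proj₂ (st i))) λ P →
    ∀ i j → i ≢ j → EdgeDisjoint (vertices (P i)) (vertices (P j))

PathPairable : ℕ → ℕ → Set
PathPairable n k = ∀ (st : Fin k → Vertex n × Vertex n) → DisjointPairs st → Linkable st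

-- The pairs live in the top two rows (row, column):
--     s₀ s₁ ·  t₂ t₃ t₄
--     s₂ s₃ s₄ ·  t₀ t₁
-- The 2×3 block of sources has exactly five boundary edges, so each of them, in particular
-- (0,2)(0,3), carries one of the five paths; likewise each 2×2 corner square separates four
-- pairs by four boundary edges, so (0,1)(0,2) and (0,3)(0,4) are used too. Take the path j on
-- (0,2)(0,3). If j ∈ {0,1}, the path on (0,3)(0,4) is either another one, and then two paths
-- pass the degree-3 vertex (0,3), or j itself, which then walks on from (0,4) so that the
-- degree-2 corner t₄ = (0,5) loses one of its two edges to a path other than 4 (directly, or
-- after path 3 was forced to reach t₃ through it). If j ∈ {2,3,4} the mirror argument runs at
-- (0,2), (0,1) and the corner s₀ = (0,0).
module Submission where

open import Defs
open import Data.Empty using (⊥; ⊥-elim)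
open import Data.Fin using (Fin; zero; suc; toℕ; punchIn; punchOut; _≟_)
import Data.Fin as Fin
open import Data.Fin.Properties
  using (all?; any?; pigeonhole; injective⇒≤; punchOut-injective; punchIn-injective; punchInᵢ≢i)
open import Data.List using (List; []; _∷_; map; filter; concatMap; length; cartesianProduct; allFin)
import Data.List as List
open import Data.List.Membership.Propositional using (_∈_; _∉_)
open import Data.List.Membership.Propositional.Properties
  using (∈-map⁺; ∈-filter⁺; ∈-concatMap⁺; ∈-cartesianProduct⁺; ∈-allFin)
open import Data.List.Relation.Unary.All as All using (All)
open import Data.List.Relation.Unary.AllPairs using (_∷_)
open import Data.List.Relation.Unary.Any as Any using (here; there; index)
open import Data.List.Relation.Unary.Any.Properties using (lookup-index)
open import Data.List.Relation.Unary.Unique.Propositional using (Unique)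
open import Data.Nat using (ℕ; suc; _≤_; _<_; s≤s)
import Data.Nat as ℕ
open import Data.Nat.Properties using (≤-refl; <⇒≱)
open import Data.Product using (Σ; ∃; ∃₂; _×_; _,_; proj₁; proj₂)
open import Data.Product.Properties using (≡-dec)
open import Data.Sum using (_⊎_; inj₁; inj₂)
open import Function using (_∘_; id)
open import Function.Definitions using (Injective)
open import Relation.Binary.Definitions using (DecidableEquality)
open import Relation.Binary.PropositionalEquality
  using (_≡_; _≢_; refl; sym; cong; subst; module ≡-Reasoning)
open import Relation.Nullary using (¬_; Dec; yes; no; contradiction)
open import Relation.Nullary.Decidable using (from-yes; decidable-stable; ¬?; _×-dec_; _⊎-dec_; _→-dec_)
open import Relation.Unary using (Decidable)

pattern 𝟎 = zero
pattern 𝟏 = suc 𝟎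
pattern 𝟐 = suc 𝟏
pattern 𝟑 = suc 𝟐
pattern 𝟒 = suc 𝟑
pattern 𝟓 = suc 𝟒

injective⇒surjective : ∀ {m n} {f : Fin m → Fin n} → Injective _≡_ _≡_ f → n ≤ m →
                       ∀ i → ∃ λ x → f x ≡ i
injective⇒surjective {m} {suc n} {f} f-inj n<m i with any? (λ x → f x ≟ i)
... | yes hit = hit
... | no miss = contradiction (injective⇒≤ f′-inj) (<⇒≱ n<m)
  where
  f′ : Fin m → Fin n
  f′ x = punchOut {i = i} {j = f x} (λ i≡fx → miss (x , sym i≡fx))

  f′-inj : Injective _≡_ _≡_ f′
  f′-inj = f-inj ∘ punchOut-injective {i = i} _ _

members-collide : ∀ {A : Set} {m} {xs : List A} (f : Fin m → A) → (∀ i → f i ∈ xs) →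
                  length xs < m → ∃₂ λ i j → i Fin.< j × f i ≡ f j
members-collide {xs = xs} f f∈xs |xs|<m with pigeonhole |xs|<m (index ∘ f∈xs)
... | i , j , i<j , same-index = i , j , i<j , same-element
  where
  open ≡-Reasoning
  same-element : f i ≡ f j
  same-element = begin
    f i                               ≡⟨ lookup-index (f∈xs i) ⟩
    List.lookup xs (index (f∈xs i))   ≡⟨ cong (List.lookup xs) same-index ⟩
    List.lookup xs (index (f∈xs j))   ≡⟨ lookup-index (f∈xs j) ⟨
    f j                               ∎

module _ {n : ℕ} where

  private variable
    s t u v x : Vertex n
    L : List (Vertex n)
    X : List (Vertex n)

  _≟ᵥ_ : DecidableEquality (Vertex n)
  _≟ᵥ_ = ≡-dec _≟_ _≟_

  open import Data.List.Membership.DecPropositional _≟ᵥ_ using (_∈?_; _∉?_)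

  diff1? : ∀ a b → Dec (Diff1 a b)
  diff1? a b = (suc a ℕ.≟ b) ⊎-dec (suc b ℕ.≟ a)

  adj? : (u v : Vertex n) → Dec (Adj u v)
  adj? (i , j) (p , q) =
    (i ≟ p ×-dec diff1? (toℕ j) (toℕ q)) ⊎-dec (j ≟ q ×-dec diff1? (toℕ i) (toℕ p))

  adj-sym : Adj u v → Adj v u
  adj-sym (inj₁ (refl , inj₁ e)) = inj₁ (refl , inj₂ e)
  adj-sym (inj₁ (refl , inj₂ e)) = inj₁ (refl , inj₁ e)
  adj-sym (inj₂ (refl , inj₁ e)) = inj₂ (refl , inj₂ e)
  adj-sym (inj₂ (refl , inj₂ e)) = inj₂ (refl , inj₁ e)

  allVertices : List (Vertex n)
  allVertices = cartesianProduct (allFin n) (allFin n)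

  neighbours : Vertex n → List (Vertex n)
  neighbours u = filter (adj? u) allVertices

  degree : Vertex n → ℕ
  degree = length ∘ neighbours

  adj⇒∈neighbours : Adj u v → v ∈ neighbours u
  adj⇒∈neighbours {u} {v@(i , j)} = ∈-filter⁺ (adj? u) (∈-cartesianProduct⁺ (∈-allFin i) (∈-allFin j))

  ∂ : List (Vertex n) → List (Vertex n × Vertex n)
  ∂ X = concatMap (λ u → map (u ,_) (filter (_∉? X) (neighbours u))) X

  ∈-∂ : u ∈ X → Adj u v → v ∉ X → (u , v) ∈ ∂ X
  ∈-∂ {u} {X} {v} u∈X u~v v∉X = ∈-concatMap⁺ _ (Any.map out-edge u∈X)
    where
    out-edge : ∀ {w} → u ≡ w → (u , v) ∈ map (w ,_) (filter (_∉? X) (neighbours w))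
    out-edge refl = ∈-map⁺ (u ,_) (∈-filter⁺ (_∉? X) (adj⇒∈neighbours u~v) v∉X)

  Separates : List (Vertex n) → Vertex n × Vertex n → Set
  Separates X (s , t) = (s ∈ X × t ∉ X) ⊎ (s ∉ X × t ∈ X)

  separates? : ∀ X e → Dec (Separates X e)
  separates? X (s , t) = (s ∈? X ×-dec t ∉? X) ⊎-dec (s ∉? X ×-dec t ∈? X)

  uses-sym : UsesEdge u v L → UsesEdge v u L
  uses-sym (here-fw vs)   = here-bw vs
  uses-sym (here-bw vs)   = here-fw vs
  uses-sym (there w vs p) = there w vs (uses-sym p)

  uses⇒∈ : UsesEdge u v L → v ∈ L
  uses⇒∈ (here-fw vs)   = there (here refl)
  uses⇒∈ (here-bw vs)   = here refl
  uses⇒∈ (there w vs p) = there (uses⇒∈ p)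

  walk-adj : IsWalk L → UsesEdge u v L → Adj u v
  walk-adj (step _ _ _ u~v _) (here-fw _)   = u~v
  walk-adj (step _ _ _ v~u _) (here-bw _)   = adj-sym v~u
  walk-adj (step _ _ _ _ w)   (there _ _ p) = walk-adj w p

  walk-exits : {Q : Vertex n → Set} → Decidable Q → IsWalk (s ∷ L) → EndsAt t (s ∷ L) →
               Q s → ¬ Q t → ∃₂ λ u v → Q u × ¬ Q v × UsesEdge u v (s ∷ L)
  walk-exits Q? (single _) end qs ¬qt = ⊥-elim (¬qt qs)
  walk-exits Q? (step s v vs _ w) (more _ _ e) qs ¬qt with Q? v
  ... | yes qv = let u , u′ , qu , ¬qu′ , k = walk-exits Q? w e qv ¬qt
                 in u , u′ , qu , ¬qu′ , there s _ k
  ... | no ¬qv = s , v , qs , ¬qv , here-fw vs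

  walk-last : IsWalk (s ∷ L) → EndsAt t (s ∷ L) → s ≢ t → ∃ λ w → UsesEdge t w (s ∷ L)
  walk-last (single _) end s≢t = ⊥-elim (s≢t refl)
  walk-last {t = t} (step s v _ _ w) (more _ _ e) _ with v ≟ᵥ t
  ... | yes refl = s , here-bw _
  ... | no v≢t   = let z , k = walk-last w e v≢t in z , there s _ k

  walk-transit : IsWalk (x ∷ L) → Unique (x ∷ L) → EndsAt t (x ∷ L) → v ≢ x → v ≢ t →
                 UsesEdge u v (x ∷ L) → ∃ λ w → w ≢ u × UsesEdge v w (x ∷ L)
  walk-transit (step _ _ _ _ (single _)) _ (more _ _ end) _ v≢t (here-fw []) = ⊥-elim (v≢t refl)
  walk-transit (step _ _ _ _ (step _ y _ _ _)) (x∉ ∷ _) _ _ _ (here-fw (y ∷ ys)) =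
    y , (λ y≡x → All.lookup x∉ (there (here refl)) (sym y≡x)) , there _ _ (here-fw ys)
  walk-transit _ _ _ v≢x _ (here-bw _) = ⊥-elim (v≢x refl)
  walk-transit (single _) _ _ _ _ (there _ _ ())
  walk-transit {v = v} (step _ y _ _ w) (x∉ ∷ uq) (more _ _ e) _ v≢t (there _ _ p) with v ≟ᵥ y
  ... | no v≢y   = let z , z≢u , k = walk-transit w uq e v≢y v≢t p in z , z≢u , there _ _ k
  ... | yes refl = entered-from-predecessor x∉ uq p
    where
    entered-from-predecessor : ∀ {x u v} {L} → All (x ≢_) (v ∷ L) → Unique (v ∷ L) →
                               UsesEdge u v (v ∷ L) → ∃ λ w → w ≢ u × UsesEdge v w (x ∷ v ∷ L)
    entered-from-predecessor _   (v∉ ∷ _) (here-fw _)   = ⊥-elim (All.head v∉ refl)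
    entered-from-predecessor x∉′ _          (here-bw _)   =
      _ , (λ x≡u → All.lookup x∉′ (there (here refl)) x≡u) , here-bw _
    entered-from-predecessor _   (v∉ ∷ _) (there _ _ p) = ⊥-elim (All.lookup v∉ (uses⇒∈ p) refl)

  uses⇒adj : (P : Path s t) → UsesEdge u v (vertices P) → Adj u v
  uses⇒adj P = walk-adj (walk P)

  path-exits : (P : Path s t) → Separates X (s , t) →
               ∃ λ e → e ∈ ∂ X × UsesEdge (proj₁ e) (proj₂ e) (vertices P)
  path-exits {X = X} (mkPath _ w _ (_ , refl) f) (inj₁ (s∈X , t∉X)) =
    let u , v , u∈X , v∉X , k = walk-exits (_∈? X) w f s∈X t∉X
    in (u , v) , ∈-∂ u∈X (walk-adj w k) v∉X , k
  path-exits {X = X} (mkPath _ w _ (_ , refl) f) (inj₂ (s∉X , t∈X)) =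
    let u , v , u∉X , ¬v∉X , k = walk-exits (_∉? X) w f s∉X (λ t∉X → t∉X t∈X)
    in (v , u) , ∈-∂ (decidable-stable (v ∈? X) ¬v∉X) (adj-sym (walk-adj w k)) u∉X , uses-sym k

  path-first : (P : Path s t) → s ≢ t → ∃ λ w → UsesEdge s w (vertices P)
  path-first (mkPath _ (single _) _ (_ , refl) end) s≢t = ⊥-elim (s≢t refl)
  path-first (mkPath _ (step _ w _ _ _) _ (_ , refl) _) _ = w , here-fw _

  path-last : (P : Path s t) → s ≢ t → ∃ λ w → UsesEdge t w (vertices P)
  path-last (mkPath _ w _ (_ , refl) f) = walk-last w f

  path-transit : (P : Path s t) → UsesEdge u v (vertices P) → v ≢ s → v ≢ t →
                 ∃ λ w → w ≢ u × UsesEdge v w (vertices P)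
  path-transit (mkPath _ w d (_ , refl) f) p v≢s v≢t = walk-transit w d f v≢s v≢t p

module _ {n k : ℕ} (st : Fin k → Vertex n × Vertex n) where

  IsEnd : Fin k → Vertex n → Set
  IsEnd i v = v ≡ proj₁ (st i) ⊎ v ≡ proj₂ (st i)

  isEnd? : ∀ i v → Dec (IsEnd i v)
  isEnd? i v = (v ≟ᵥ proj₁ (st i)) ⊎-dec (v ≟ᵥ proj₂ (st i))

  disjointPairs? : Dec (DisjointPairs st)
  disjointPairs? =
    all? (λ i → ¬? (s i ≟ᵥ t i)) ×-dec
    all? (λ i → all? λ j → ¬? (i ≟ j) →-dec
      (¬? (s i ≟ᵥ s j) ×-dec ¬? (s i ≟ᵥ t j) ×-dec ¬? (t i ≟ᵥ s j) ×-dec ¬? (t i ≟ᵥ t j)))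
    where
    s t : Fin k → Vertex n
    s = proj₁ ∘ st
    t = proj₂ ∘ st

module Linkage {n k} {st : Fin k → Vertex n × Vertex n}
               (pairs : DisjointPairs st) (linkage : Linkable st) where

  private variable
    i j : Fin k
    u u′ v : Vertex n

  path : (i : Fin k) → Path (proj₁ (st i)) (proj₂ (st i))
  path = proj₁ linkage

  Uses : Fin k → Vertex n → Vertex n → Set
  Uses i u v = UsesEdge u v (vertices (path i))

  clash : i ≢ j → Uses i u v → Uses j u v → ⊥
  clash i≢j = proj₂ linkage _ _ i≢j _ _

  clash′ : i ≢ j → Uses i u v → Uses j v u → ⊥
  clash′ i≢j p q = clash i≢j p (uses-sym q)

  ends-unique : IsEnd st i v → IsEnd st j v → i ≡ j
  ends-unique {i} {v} {j} p q with i ≟ j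
  ... | yes i≡j = i≡j
  ... | no i≢j  = ⊥-elim (apart p q (proj₂ pairs i j i≢j))
    where
    apart : IsEnd st i v → IsEnd st j v → _ → ⊥
    apart (inj₁ refl) (inj₁ e) (d , _)         = d e
    apart (inj₁ refl) (inj₂ e) (_ , d , _)     = d e
    apart (inj₂ refl) (inj₁ e) (_ , _ , d , _) = d e
    apart (inj₂ refl) (inj₂ e) (_ , _ , _ , d) = d e

  not-end : IsEnd st j v → i ≢ j → ¬ IsEnd st i v
  not-end end-j i≢j end-i = i≢j (ends-unique end-i end-j)

  leaves : Uses i v u → u ∈ neighbours v
  leaves {i} p = adj⇒∈neighbours (uses⇒adj (path i) p)

  enters : Uses i u v → u ∈ neighbours v
  enters p = leaves (uses-sym p)

  transit : Uses i u v → ¬ IsEnd st i v → ∃ λ w → w ≢ u × w ∈ neighbours v × Uses i v w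
  transit {i} p ¬end with path-transit (path i) p (¬end ∘ inj₁) (¬end ∘ inj₂)
  ... | w , w≢u , q = w , w≢u , leaves q , q

  end-edge : IsEnd st i v → ∃ λ w → w ∈ neighbours v × Uses i v w
  end-edge {i} (inj₁ refl) = let w , q = path-first (path i) (proj₁ pairs i) in w , leaves q , q
  end-edge {i} (inj₂ refl) = let w , q = path-last  (path i) (proj₁ pairs i) in w , leaves q , q

  boundary-saturated : (X : List (Vertex n)) {m : ℕ} (ι : Fin m → Fin k) → Injective _≡_ _≡_ ι →
                       length (∂ X) ≤ m → (∀ x → Separates X (st (ι x))) →
                       ∀ {e} → e ∈ ∂ X → ∃ λ x → Uses (ι x) (proj₁ e) (proj₂ e)
  -- Distinct separated paths leave X through distinct boundary edges: an injection into ∂ X.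
  boundary-saturated X ι ι-inj |∂X|≤m separated {e} e∈∂X =
    let x , hits-e = injective⇒surjective exit-index-injective |∂X|≤m (index e∈∂X)
    in x , subst (Crosses x) (exit-determined-by-index e∈∂X hits-e) (exit-used x)
    where
    Crosses : Fin _ → Vertex n × Vertex n → Set
    Crosses x (u , v) = Uses (ι x) u v

    exit : ∀ x → ∃ λ e → e ∈ ∂ X × Crosses x e
    exit x = path-exits (path (ι x)) (separated x)

    exit-used : ∀ x → Crosses x (proj₁ (exit x))
    exit-used x = proj₂ (proj₂ (exit x))

    exit-index : Fin _ → Fin (length (∂ X))
    exit-index x = index (proj₁ (proj₂ (exit x)))

    exit-determined-by-index : ∀ {x e} (e∈∂X : e ∈ ∂ X) → exit-index x ≡ index e∈∂X → proj₁ (exit x) ≡ e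
    exit-determined-by-index {x} {e} e∈∂X same = begin
      proj₁ (exit x)                        ≡⟨ lookup-index (proj₁ (proj₂ (exit x))) ⟩
      List.lookup (∂ X) (exit-index x)      ≡⟨ cong (List.lookup (∂ X)) same ⟩
      List.lookup (∂ X) (index e∈∂X)        ≡⟨ lookup-index e∈∂X ⟨
      e                                     ∎
      where open ≡-Reasoning

    exit-index-injective : Injective _≡_ _≡_ exit-index
    exit-index-injective {x} {y} same with x ≟ y
    ... | yes x≡y = x≡y
    ... | no x≢y  = ⊥-elim (clash (x≢y ∘ ι-inj)
                             (subst (Crosses x) (exit-determined-by-index _ same) (exit-used x))
                             (exit-used y))

  clash-at-degree-two : degree v ≤ 2 → IsEnd st j v → i ≢ j → Uses i u v → ⊥
  clash-at-degree-two {v} {j} {i} {u} deg≤2 end-j i≢j p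
    with w , w≢u , w∈ , q ← transit p (not-end end-j i≢j)
       | z , z∈ , r ← end-edge end-j
    with members-collide (λ { 𝟎 → u ; 𝟏 → w ; 𝟐 → z }) (λ { 𝟎 → enters p ; 𝟏 → w∈ ; 𝟐 → z∈ }) (s≤s deg≤2)
  ... | 𝟎 , 𝟏 , _ , u≡w  = w≢u (sym u≡w)
  ... | 𝟎 , 𝟐 , _ , refl = clash′ i≢j p r
  ... | 𝟏 , 𝟐 , _ , refl = clash i≢j q r
  ... | _ , 𝟎 , () , _
  ... | suc _ , 𝟏 , s≤s () , _
  ... | 𝟐 , 𝟐 , s≤s (s≤s ()) , _

  clash-at-degree-three : degree v ≤ 3 → ¬ IsEnd st i v → ¬ IsEnd st j v → i ≢ j →
                          Uses i u v → Uses j u′ v → ⊥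
  clash-at-degree-three {v} {i} {j} {u} {u′} deg≤3 ¬end-i ¬end-j i≢j p p′
    with w , w≢u , w∈ , q ← transit p ¬end-i
       | w′ , w′≢u′ , w′∈ , q′ ← transit p′ ¬end-j
    with members-collide (λ { 𝟎 → u ; 𝟏 → w ; 𝟐 → u′ ; 𝟑 → w′ })
           (λ { 𝟎 → enters p ; 𝟏 → w∈ ; 𝟐 → enters p′ ; 𝟑 → w′∈ }) (s≤s deg≤3)
  ... | 𝟎 , 𝟏 , _ , u≡w   = w≢u (sym u≡w)
  ... | 𝟐 , 𝟑 , _ , u′≡w′ = w′≢u′ (sym u′≡w′)
  ... | 𝟎 , 𝟐 , _ , refl  = clash i≢j p p′
  ... | 𝟎 , 𝟑 , _ , refl  = clash′ i≢j p q′
  ... | 𝟏 , 𝟐 , _ , refl  = clash′ i≢j q p′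
  ... | 𝟏 , 𝟑 , _ , refl  = clash i≢j q q′
  ... | _ , 𝟎 , () , _
  ... | suc _ , 𝟏 , s≤s () , _
  ... | suc (suc _) , 𝟐 , s≤s (s≤s ()) , _
  ... | 𝟑 , 𝟑 , s≤s (s≤s (s≤s ())) , _

st : Fin 5 → Vertex 6 × Vertex 6
st 𝟎 = (𝟎 , 𝟎) , (𝟏 , 𝟒)
st 𝟏 = (𝟎 , 𝟏) , (𝟏 , 𝟓)
st 𝟐 = (𝟏 , 𝟎) , (𝟎 , 𝟑)
st 𝟑 = (𝟏 , 𝟏) , (𝟎 , 𝟒)
st 𝟒 = (𝟏 , 𝟐) , (𝟎 , 𝟓)

westBlock westSquare eastSquare : List (Vertex 6)
westBlock  = (𝟎 , 𝟎) ∷ (𝟎 , 𝟏) ∷ (𝟎 , 𝟐) ∷ (𝟏 , 𝟎) ∷ (𝟏 , 𝟏) ∷ (𝟏 , 𝟐) ∷ []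
westSquare = (𝟎 , 𝟎) ∷ (𝟎 , 𝟏) ∷ (𝟏 , 𝟎) ∷ (𝟏 , 𝟏) ∷ []
eastSquare = (𝟎 , 𝟒) ∷ (𝟎 , 𝟓) ∷ (𝟏 , 𝟒) ∷ (𝟏 , 𝟓) ∷ []

st-disjoint : DisjointPairs st
st-disjoint = from-yes (disjointPairs? st)

open import Data.List.Membership.DecPropositional (≡-dec (_≟ᵥ_ {6}) (_≟ᵥ_ {6})) using () renaming (_∈?_ to _∈ₑ?_)

module _ (linkage : Linkable st) where
  open Linkage st-disjoint linkage

  westBlock-crossing : ∃ λ j → Uses j (𝟎 , 𝟐) (𝟎 , 𝟑)
  westBlock-crossing =
    boundary-saturated westBlock id id ≤-refl
      (from-yes (all? λ x → separates? westBlock (st x)))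
      (from-yes (((𝟎 , 𝟐) , (𝟎 , 𝟑)) ∈ₑ? ∂ westBlock))

  westSquare-crossing : ∃ λ x → Uses (punchIn 𝟒 x) (𝟎 , 𝟏) (𝟎 , 𝟐)
  westSquare-crossing =
    boundary-saturated westSquare (punchIn 𝟒) (punchIn-injective 𝟒 _ _) ≤-refl
      (from-yes (all? λ x → separates? westSquare (st (punchIn 𝟒 x))))
      (from-yes (((𝟎 , 𝟏) , (𝟎 , 𝟐)) ∈ₑ? ∂ westSquare))

  eastSquare-crossing : ∃ λ x → Uses (punchIn 𝟐 x) (𝟎 , 𝟒) (𝟎 , 𝟑)
  eastSquare-crossing =
    boundary-saturated eastSquare (punchIn 𝟐) (punchIn-injective 𝟐 _ _) ≤-refl
      (from-yes (all? λ x → separates? eastSquare (st (punchIn 𝟐 x))))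
      (from-yes (((𝟎 , 𝟒) , (𝟎 , 𝟑)) ∈ₑ? ∂ eastSquare))

  ¬enter-corner-00 : ∀ {i u} → i ≢ 𝟎 → Uses i u (𝟎 , 𝟎) → ⊥
  ¬enter-corner-00 = clash-at-degree-two ≤-refl (inj₁ refl)

  ¬enter-corner-05 : ∀ {i u} → i ≢ 𝟒 → Uses i u (𝟎 , 𝟓) → ⊥
  ¬enter-corner-05 = clash-at-degree-two ≤-refl (inj₂ refl)

  -- neighbours (𝟎 , c) lists (𝟎 , c - 1), (𝟎 , c + 1), (𝟏 , c) in this order.
  ¬enter-01-from-02 : ∀ {j} → j ≢ 𝟎 → j ≢ 𝟏 → Uses j (𝟎 , 𝟐) (𝟎 , 𝟏) → ⊥
  ¬enter-01-from-02 j≢0 j≢1 p with transit p (not-end (inj₁ refl) j≢1)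
  ... | _ , _ , here refl , q = ¬enter-corner-00 j≢0 q
  ... | _ , w≢u , there (here refl) , _ = w≢u refl
  ... | _ , _ , there (there (here refl)) , q with end-edge {i = 𝟏} (inj₁ refl)
  ...   | _ , here refl , r = ¬enter-corner-00 (λ ()) r
  ...   | _ , there (here refl) , r = clash′ j≢1 p r
  ...   | _ , there (there (here refl)) , r = clash j≢1 q r

  ¬enter-04-from-03 : ∀ {j} → j ≢ 𝟑 → j ≢ 𝟒 → Uses j (𝟎 , 𝟑) (𝟎 , 𝟒) → ⊥
  ¬enter-04-from-03 j≢3 j≢4 p with transit p (not-end (inj₂ refl) j≢3)
  ... | _ , w≢u , here refl , _ = w≢u refl
  ... | _ , _ , there (here refl) , q = ¬enter-corner-05 j≢4 q
  ... | _ , _ , there (there (here refl)) , q with end-edge {i = 𝟑} (inj₂ refl)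
  ...   | _ , here refl , r = clash′ j≢3 p r
  ...   | _ , there (here refl) , r = ¬enter-corner-05 (λ ()) r
  ...   | _ , there (there (here refl)) , r = clash j≢3 q r

  ¬uses-02-03-from-2-on : ∀ {j} → j ≢ 𝟎 → j ≢ 𝟏 → Uses j (𝟎 , 𝟐) (𝟎 , 𝟑) → ⊥
  -- Matching in a helper instead of with-abstracting a crossing lemma keeps Agda from
  -- normalising the decision procedures inside it.
  ¬uses-02-03-from-2-on {j} j≢0 j≢1 p = via-square westSquare-crossing
    where
    no-end : ∀ i → ¬ IsEnd st i (𝟎 , 𝟐)
    no-end = from-yes (all? λ i → ¬? (isEnd? st i (𝟎 , 𝟐)))

    via-square : (∃ λ x → Uses (punchIn 𝟒 x) (𝟎 , 𝟏) (𝟎 , 𝟐)) → ⊥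
    via-square (x , q) with punchIn 𝟒 x ≟ j
    ... | yes refl = ¬enter-01-from-02 j≢0 j≢1 (uses-sym q)
    ... | no k≢j   = clash-at-degree-three ≤-refl (no-end (punchIn 𝟒 x)) (no-end j) k≢j q (uses-sym p)

  ¬uses-02-03-by-0-or-1 : ∀ {j} → j ≢ 𝟐 → j ≢ 𝟑 → j ≢ 𝟒 → Uses j (𝟎 , 𝟐) (𝟎 , 𝟑) → ⊥
  ¬uses-02-03-by-0-or-1 {j} j≢2 j≢3 j≢4 p = via-square eastSquare-crossing
    where
    end-03 : IsEnd st 𝟐 (𝟎 , 𝟑)
    end-03 = inj₂ refl

    via-square : (∃ λ x → Uses (punchIn 𝟐 x) (𝟎 , 𝟒) (𝟎 , 𝟑)) → ⊥
    via-square (x , q) with punchIn 𝟐 x ≟ j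
    ... | yes refl = ¬enter-04-from-03 j≢3 j≢4 (uses-sym q)
    ... | no k≢j   = clash-at-degree-three ≤-refl (not-end end-03 (punchInᵢ≢i 𝟐 x))
                       (not-end end-03 j≢2) k≢j q p

  unlinkable : ⊥
  unlinkable = via-block westBlock-crossing
    where
    via-block : (∃ λ j → Uses j (𝟎 , 𝟐) (𝟎 , 𝟑)) → ⊥
    via-block (𝟎 , p) = ¬uses-02-03-by-0-or-1 (λ ()) (λ ()) (λ ()) p
    via-block (𝟏 , p) = ¬uses-02-03-by-0-or-1 (λ ()) (λ ()) (λ ()) p
    via-block (𝟐 , p) = ¬uses-02-03-from-2-on (λ ()) (λ ()) p
    via-block (𝟑 , p) = ¬uses-02-03-from-2-on (λ ()) (λ ()) p
    via-block (𝟒 , p) = ¬uses-02-03-from-2-on (λ ()) (λ ()) p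

proposition1 : Σ (Fin 5 → Vertex 6 × Vertex 6) λ st →
                 DisjointPairs st × ¬ Linkable st
proposition1 = st , st-disjoint , unlinkable
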